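{- Let $\mathcal{F}$ be a finite hypergraph (a finite collection of distinct finite sets, not necessarily uniform) and let $\mathcal{M}\subseteq\mathcal{F}$ be a matching. Then $\mathcal{M}$ is a maximum matching of $\mathcal{F}$ if and only if there is no $\mathcal{M}$-augmenting set in $\mathcal{F}$.
   Context: A matching is a collection of pairwise disjoint members of $\mathcal{F}$; it is maximum if no matching of $\mathcal{F}$ has more members. For $\mathcal{C}\subseteq\mathcal{F}$ write $X_{\mathcal{C}}=\bigcup_{A\in\mathcal{C}}A$ and $\mathcal{C}_x=\{A\in\mathcal{C}: x\in A\}$. A subfamily $\mathcal{C}\subseteq\mathcal{F}$ is an $\mathcal{M}$-augmenting set if: (1) $|\mathcal{M}\cap\mathcal{C}|<|\mathcal{C}\setminus\mathcal{M}|$; (2) if $B\in\mathcal{M}$ and $B\cap A\neq\emptyset$ for some $A\in\mathcal{C}$, then $B\in\mathcal{C}$; (3) $|\mathcal{C}_x\setminus\mathcal{M}|\leq 1$ for all $x\in X_{\mathcal{C}}$ (i.e. the members of $\mathcal{C}\setminus\mathcal{M}$ are pairwise disjoint). -}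

module Defs where

open import Data.Nat using (ℕ; _≤_; _<_)
open import Data.Fin using (Fin)
open import Data.Fin.Subset using (Subset; _∈_; _∩_; _─_; ∣_∣; Empty; inside; outside)
open import Data.Vec using (tabulate)
open import Data.Product using (Σ; ∃; _×_)
open import Relation.Nullary using (¬_; does)
open import Relation.Binary.PropositionalEquality using (_≡_)
open import Data.Bool using (if_then_else_)
open import Data.Fin.Subset.Properties using (_∈?_)
open import Function.Definitions using (Injective)

-- A finite hypergraph on the vertex set Fin n with m edges, given as an
-- injective indexing  F : Fin m → Subset n  (injective = the edges are distinct).
-- A subfamily of F is a subset of edge indices  C : Subset m.
record Hypergraph : Set where
  field
    n     : ℕ
    m     : ℕ
    edge  : Fin m → Subset n
    distinct : Injective _≡_ _≡_ edge

module _ (H : Hypergraph) where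
  open Hypergraph H

  Family : Set
  Family = Subset m

  IsMatching : Family → Set
  IsMatching M = ∀ i j → i ∈ M → j ∈ M → ¬ (i ≡ j) → Empty (edge i ∩ edge j)

  IsMaximum : Family → Set
  IsMaximum M = IsMatching M × (∀ M′ → IsMatching M′ → ∣ M′ ∣ ≤ ∣ M ∣)

  _∈X_ : Fin n → Family → Set
  x ∈X C = ∃ λ i → i ∈ C × x ∈ edge i

  fam-at : Family → Fin n → Family
  fam-at C x = tabulate λ i →
    if does (i ∈? C) then (if does (x ∈? edge i) then inside else outside) else outside

  IsAugmenting : Family → Family → Set
  IsAugmenting M C =
    (∣ M ∩ C ∣ < ∣ C ─ M ∣)
    × (∀ B A → B ∈ M → A ∈ C → ¬ Empty (edge B ∩ edge A) → B ∈ C)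
    × (∀ x → x ∈X C → ∣ fam-at C x ─ M ∣ ≤ 1)

-- Exchanging M with an augmenting set C turns M into M △ C, which is again a
-- matching (condition (2) keeps the new members away from M ∖ C, condition (3)
-- keeps them apart from each other) and has |M| − |M ∩ C| + |C ∖ M| > |M|
-- members. Conversely, for a matching M′ larger than M, the symmetric
-- difference M △ M′ is M-augmenting, because M △ (M △ M′) = M′.
module Submission where

open import Defs
open import Data.Nat using (ℕ; _+_; _≤_; _<_; z≤n; s≤s)
open import Data.Nat.Properties
  using (+-comm; +-suc; +-monoʳ-<; +-cancelˡ-<; <⇒≱; ≮⇒≥; ≤-reflexive)
open import Data.Fin using (Fin; suc; _≟_)
open import Data.Fin.Properties using (suc-injective)
open import Data.Fin.Subset
  using (Subset; _∈_; _∉_; _∩_; _∪_; _─_; ∣_∣; Empty; inside; outside)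
open import Data.Fin.Subset.Properties
  using (_∈?_; x∈p∩q⁺; x∈p∩q⁻; x∈p∪q⁺; x∈p∪q⁻; x∈p∧x∉q⇒x∈p─q; p─q⊆p;
         ∩-comm; p⊆q⇒∣p∣≤∣q∣; x∈⁅y⁆⇒x≡y; ∣⁅x⁆∣≡1; Empty-unique; ∣⊥∣≡0)
open import Data.Vec using ([]; _∷_; here; there)
open import Data.Vec.Properties using (lookup∘tabulate; lookup⇒[]=; []=⇒lookup)
open import Data.Product using (∃; _×_; _,_)
open import Data.Sum using (_⊎_; inj₁; inj₂)
open import Data.Empty using (⊥-elim)
open import Data.Bool using (if_then_else_)
open import Function.Bundles using (_⇔_; mk⇔; Equivalence)
open import Relation.Nullary using (¬_; Dec; yes; no; does)
open import Relation.Nullary.Decidable using (dec-true)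
open import Relation.Binary.PropositionalEquality
  using (_≡_; refl; sym; trans; cong; subst)

private
  variable
    k : ℕ
    x y : Fin k
    p q : Subset k

infixr 6 _△_

_△_ : Subset k → Subset k → Subset k
p △ q = (p ─ q) ∪ (q ─ p)

x∈p─q⇒x∉q : (p q : Subset k) → x ∈ p ─ q → x ∉ q
x∈p─q⇒x∉q (_ ∷ _) (inside ∷ _) () here
x∈p─q⇒x∉q (_ ∷ p) (_ ∷ q) (there x∈p─q) (there x∈q) = x∈p─q⇒x∉q p q x∈p─q x∈q

x∈p△q⁺ : x ∈ p → x ∉ q → x ∈ p △ q
x∈p△q⁺ x∈p x∉q = x∈p∪q⁺ (inj₁ (x∈p∧x∉q⇒x∈p─q x∈p x∉q))

x∈p△q⁻ : (p q : Subset k) → x ∈ p △ q → (x ∈ p × x ∉ q) ⊎ (x ∈ q × x ∉ p)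
x∈p△q⁻ p q x∈p△q with x∈p∪q⁻ (p ─ q) (q ─ p) x∈p△q
... | inj₁ x∈p─q = inj₁ (p─q⊆p p q x∈p─q , x∈p─q⇒x∉q p q x∈p─q)
... | inj₂ x∈q─p = inj₂ (p─q⊆p q p x∈q─p , x∈p─q⇒x∉q q p x∈q─p)

p△[p△q]≡q : (p q : Subset k) → p △ (p △ q) ≡ q
p△[p△q]≡q []           []           = refl
p△[p△q]≡q (inside ∷ p)  (inside ∷ q)  = cong (inside ∷_) (p△[p△q]≡q p q)
p△[p△q]≡q (inside ∷ p)  (outside ∷ q) = cong (outside ∷_) (p△[p△q]≡q p q)
p△[p△q]≡q (outside ∷ p) (inside ∷ q)  = cong (inside ∷_) (p△[p△q]≡q p q)
p△[p△q]≡q (outside ∷ p) (outside ∷ q) = cong (outside ∷_) (p△[p△q]≡q p q)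

∣p∣≡∣p∩q∣+∣p─q∣ : (p q : Subset k) → ∣ p ∣ ≡ ∣ p ∩ q ∣ + ∣ p ─ q ∣
∣p∣≡∣p∩q∣+∣p─q∣ []           []           = refl
∣p∣≡∣p∩q∣+∣p─q∣ (inside ∷ p)  (inside ∷ q)  = cong (1 +_) (∣p∣≡∣p∩q∣+∣p─q∣ p q)
∣p∣≡∣p∩q∣+∣p─q∣ (inside ∷ p)  (outside ∷ q) =
  trans (cong (1 +_) (∣p∣≡∣p∩q∣+∣p─q∣ p q)) (sym (+-suc _ _))
∣p∣≡∣p∩q∣+∣p─q∣ (outside ∷ p) (inside ∷ q)  = ∣p∣≡∣p∩q∣+∣p─q∣ p q
∣p∣≡∣p∩q∣+∣p─q∣ (outside ∷ p) (outside ∷ q) = ∣p∣≡∣p∩q∣+∣p─q∣ p q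

∣p△q∣≡∣p─q∣+∣q─p∣ : (p q : Subset k) → ∣ p △ q ∣ ≡ ∣ p ─ q ∣ + ∣ q ─ p ∣
∣p△q∣≡∣p─q∣+∣q─p∣ []           []           = refl
∣p△q∣≡∣p─q∣+∣q─p∣ (inside ∷ p)  (inside ∷ q)  = ∣p△q∣≡∣p─q∣+∣q─p∣ p q
∣p△q∣≡∣p─q∣+∣q─p∣ (inside ∷ p)  (outside ∷ q) = cong (1 +_) (∣p△q∣≡∣p─q∣+∣q─p∣ p q)
∣p△q∣≡∣p─q∣+∣q─p∣ (outside ∷ p) (inside ∷ q)  =
  trans (cong (1 +_) (∣p△q∣≡∣p─q∣+∣q─p∣ p q)) (sym (+-suc _ _))
∣p△q∣≡∣p─q∣+∣q─p∣ (outside ∷ p) (outside ∷ q) = ∣p△q∣≡∣p─q∣+∣q─p∣ p q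

∣p∣<∣p△q∣⇔∣p∩q∣<∣q─p∣ : (p q : Subset k) → ∣ p ∣ < ∣ p △ q ∣ ⇔ ∣ p ∩ q ∣ < ∣ q ─ p ∣
∣p∣<∣p△q∣⇔∣p∩q∣<∣q─p∣ p q
  rewrite ∣p∣≡∣p∩q∣+∣p─q∣ p q | ∣p△q∣≡∣p─q∣+∣q─p∣ p q | +-comm ∣ p ∩ q ∣ ∣ p ─ q ∣ =
  mk⇔ (+-cancelˡ-< ∣ p ─ q ∣ _ _) (+-monoʳ-< ∣ p ─ q ∣)

x∈p⇒1≤∣p∣ : x ∈ p → 1 ≤ ∣ p ∣
x∈p⇒1≤∣p∣ {x = x} x∈p =
  subst (_≤ _) (∣⁅x⁆∣≡1 x) (p⊆q⇒∣p∣≤∣q∣ λ y∈⁅x⁆ → subst (_∈ _) (sym (x∈⁅y⁆⇒x≡y x y∈⁅x⁆)) x∈p)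

∣p∣≤1⇒unique : (p : Subset k) → ∣ p ∣ ≤ 1 → x ∈ p → y ∈ p → x ≡ y
∣p∣≤1⇒unique (inside ∷ p)  _            here        here        = refl
∣p∣≤1⇒unique (inside ∷ p)  (s≤s ∣p∣≤0) here        (there y∈p) = ⊥-elim (<⇒≱ (x∈p⇒1≤∣p∣ y∈p) ∣p∣≤0)
∣p∣≤1⇒unique (inside ∷ p)  (s≤s ∣p∣≤0) (there x∈p) _           = ⊥-elim (<⇒≱ (x∈p⇒1≤∣p∣ x∈p) ∣p∣≤0)
∣p∣≤1⇒unique (outside ∷ p) ∣p∣≤1       (there x∈p) (there y∈p) =
  cong suc (∣p∣≤1⇒unique p ∣p∣≤1 x∈p y∈p)

unique⇒∣p∣≤1 : (p : Subset k) → (∀ {x y} → x ∈ p → y ∈ p → x ≡ y) → ∣ p ∣ ≤ 1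
unique⇒∣p∣≤1 []                 _      = z≤n
unique⇒∣p∣≤1 {ℕ.suc k} (inside ∷ p) unique =
  s≤s (≤-reflexive (trans (cong ∣_∣ (Empty-unique p-empty)) (∣⊥∣≡0 k)))
  where
  p-empty : Empty p
  p-empty (y , y∈p) with unique here (there y∈p)
  ... | ()
unique⇒∣p∣≤1 (outside ∷ p)      unique =
  unique⇒∣p∣≤1 p λ x∈p y∈p → suc-injective (unique (there x∈p) (there y∈p))

module _ (H : Hypergraph) where
  open Hypergraph H

  private
    variable
      i j : Fin m
      v : Fin n
      C M M′ : Subset m

  ∈fam-at⁺ : i ∈ C → v ∈ edge i → i ∈ fam-at H C v
  ∈fam-at⁺ {i} {C} {v} i∈C v∈i = lookup⇒[]= i _ (trans (lookup∘tabulate _ i) selected)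
    where
    selected : (if does (i ∈? C) then (if does (v ∈? edge i) then inside else outside)
                                   else outside) ≡ inside
    selected rewrite dec-true (i ∈? C) i∈C | dec-true (v ∈? edge i) v∈i = refl

  ∈fam-at⁻ : i ∈ fam-at H C v → i ∈ C × v ∈ edge i
  ∈fam-at⁻ {i} {C} {v} i∈ =
    selected (i ∈? C) (v ∈? edge i) (trans (sym (lookup∘tabulate _ i)) ([]=⇒lookup i∈))
    where
    selected : (a : Dec (i ∈ C)) (b : Dec (v ∈ edge i)) →
               (if does a then (if does b then inside else outside) else outside) ≡ inside →
               i ∈ C × v ∈ edge i
    selected (yes i∈C) (yes v∈i) _ = i∈C , v∈i

  matching-meet⇒≡ : IsMatching H M → i ∈ M → j ∈ M → ¬ Empty (edge i ∩ edge j) → i ≡ j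
  matching-meet⇒≡ {i = i} {j} isMatching i∈M j∈M meet with i ≟ j
  ... | yes i≡j = i≡j
  ... | no i≢j  = ⊥-elim (meet (isMatching i j i∈M j∈M i≢j))

  augment-isMatching : IsMatching H M → IsAugmenting H M C → IsMatching H (M △ C)
  augment-isMatching {M} {C} isMatching (_ , closed , local) i j i∈ j∈ i≢j
    with x∈p△q⁻ M C i∈ | x∈p△q⁻ M C j∈
  ... | inj₁ (i∈M , _)   | inj₁ (j∈M , _)   = isMatching i j i∈M j∈M i≢j
  ... | inj₁ (i∈M , i∉C) | inj₂ (j∈C , _)   =
    λ meet → i∉C (closed i j i∈M j∈C λ disjoint → disjoint meet)
  ... | inj₂ (i∈C , _)   | inj₁ (j∈M , j∉C) =
    λ meet → j∉C (closed j i j∈M i∈C λ disjoint →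
                    subst Empty (∩-comm (edge j) (edge i)) disjoint meet)
  ... | inj₂ (i∈C , i∉M) | inj₂ (j∈C , j∉M) = λ (v , v∈i∩j) →
    let v∈i , v∈j = x∈p∩q⁻ (edge i) (edge j) v∈i∩j
    in i≢j (∣p∣≤1⇒unique _ (local v (i , i∈C , v∈i))
              (x∈p∧x∉q⇒x∈p─q (∈fam-at⁺ i∈C v∈i) i∉M)
              (x∈p∧x∉q⇒x∈p─q (∈fam-at⁺ j∈C v∈j) j∉M))

  △-augmenting : IsMatching H M → IsMatching H M′ → ∣ M ∣ < ∣ M′ ∣ → IsAugmenting H M (M △ M′)
  △-augmenting {M} {M′} isMatching isMatching′ larger = grows , closed , local
    where
    grows : ∣ M ∩ (M △ M′) ∣ < ∣ (M △ M′) ─ M ∣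
    grows = Equivalence.to (∣p∣<∣p△q∣⇔∣p∩q∣<∣q─p∣ M (M △ M′))
              (subst (∣ M ∣ <_) (cong ∣_∣ (sym (p△[p△q]≡q M M′))) larger)

    closed : ∀ B A → B ∈ M → A ∈ M △ M′ → ¬ Empty (edge B ∩ edge A) → B ∈ M △ M′
    closed B A B∈M A∈ meet with B ∈? M′
    ... | no B∉M′ = x∈p△q⁺ B∈M B∉M′
    ... | yes B∈M′ with x∈p△q⁻ M M′ A∈
    ...   | inj₁ (A∈M , _)  =
      subst (_∈ M △ M′) (sym (matching-meet⇒≡ isMatching B∈M A∈M meet)) A∈
    ...   | inj₂ (A∈M′ , _) =
      subst (_∈ M △ M′) (sym (matching-meet⇒≡ isMatching′ B∈M′ A∈M′ meet)) A∈

    unmatched-member : i ∈ fam-at H (M △ M′) v ─ M → i ∈ M′ × v ∈ edge i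
    unmatched-member {i} {v} i∈ with ∈fam-at⁻ (p─q⊆p _ M i∈)
    ... | i∈C , v∈i with x∈p△q⁻ M M′ i∈C
    ...   | inj₁ (i∈M , _)  = ⊥-elim (x∈p─q⇒x∉q _ M i∈ i∈M)
    ...   | inj₂ (i∈M′ , _) = i∈M′ , v∈i

    local : ∀ v → _∈X_ H v (M △ M′) → ∣ fam-at H (M △ M′) v ─ M ∣ ≤ 1
    local v _ = unique⇒∣p∣≤1 _ λ i∈ j∈ →
      let i∈M′ , v∈i = unmatched-member i∈
          j∈M′ , v∈j = unmatched-member j∈
      in matching-meet⇒≡ isMatching′ i∈M′ j∈M′ λ disjoint → disjoint (v , x∈p∩q⁺ (v∈i , v∈j))

lemma1 : (H : Hypergraph) (M : Subset (Hypergraph.m H)) → IsMatching H M →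
    (IsMaximum H M ⇔ (¬ ∃ λ C → IsAugmenting H M C))
lemma1 H M isMatching = mk⇔ no-augmenting-set maximum
  where
  no-augmenting-set : IsMaximum H M → ¬ ∃ λ C → IsAugmenting H M C
  no-augmenting-set (_ , maximal) (C , augmenting@(grows , _)) =
    <⇒≱ (Equivalence.from (∣p∣<∣p△q∣⇔∣p∩q∣<∣q─p∣ M C) grows)
        (maximal (M △ C) (augment-isMatching H isMatching augmenting))

  maximum : ¬ (∃ λ C → IsAugmenting H M C) → IsMaximum H M
  maximum no-augmenting = isMatching , λ M′ isMatching′ → ≮⇒≥ λ larger →
    no-augmenting (M △ M′ , △-augmenting H isMatching isMatching′ larger)
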